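{- Let $v>3$ and let $(X,\mathcal{B})$ be a partial Steiner triple system of order $v$ with point set $X=\{1,\dots,v\}$. Then there is a sequencing $\pi=[x_1\,x_2\,\cdots\,x_v]$ of $X$ that is $3$-good for $(X,\mathcal{B})$, i.e. $\{x_i,x_{i+1},x_{i+2}\}\notin\mathcal{B}$ for all $1\le i\le v-2$.
   Context: A partial Steiner triple system of order $v$ is a pair $(X,\mathcal{B})$ where $X$ is a set of $v$ points and $\mathcal{B}$ is a set of 3-subsets of $X$ (blocks) such that every pair of distinct points lies in at most one block. A sequencing of $X$ is an ordering of all points of $X$, each appearing exactly once. A sequencing is $3$-good if no three consecutive points in it form a block. -}

module Defs where

open import Data.Nat using (ℕ; suc; _+_; _<_)
open import Data.Fin using (Fin; fromℕ<)
open import Data.Fin.Subset using (Subset; _∈_; ∣_∣; ⁅_⁆; _∪_)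
open import Data.List using (List)
import Data.List.Membership.Propositional as L
open import Data.Product using (_×_; Σ)
open import Function.Bundles using (_↔_; Inverse)
open import Data.Nat.Properties using (<-trans; n<1+n)
open import Relation.Binary.PropositionalEquality using (_≡_; _≢_)
open import Relation.Nullary using (¬_)

-- A block is a 3-subset of the point set Fin v (subsets as characteristic vectors,
-- so equality of sets is propositional equality).
IsBlock : {v : ℕ} → Subset v → Set
IsBlock B = ∣ B ∣ ≡ 3

record PSTS (v : ℕ) : Set where
  field
    blocks      : List (Subset v)
    blocks-3    : ∀ {B} → B L.∈ blocks → IsBlock B
    pair-unique : ∀ (x y : Fin v) → x ≢ y → ∀ {B C} →
                  B L.∈ blocks → C L.∈ blocks →
                  x ∈ B → y ∈ B → x ∈ C → y ∈ C → B ≡ C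
open PSTS public

triple : {v : ℕ} → Fin v → Fin v → Fin v → Subset v
triple a b c = ⁅ a ⁆ ∪ (⁅ b ⁆ ∪ ⁅ c ⁆)

-- A sequencing of X = Fin v: a bijection π : Fin v ↔ Fin v, read as
-- [π(0) π(1) ... π(v-1)] (each point appears exactly once).
Sequencing : ℕ → Set
Sequencing v = Fin v ↔ Fin v

-- 3-good: no three consecutive points form a block.  Positions are 0-based:
-- for every i with i+2 < v, {π(i), π(i+1), π(i+2)} is not a block.
ThreeGood : {v : ℕ} → PSTS v → Sequencing v → Set
ThreeGood {v} S π =
  ∀ (i : ℕ) (h : suc (suc i) < v) →
    ¬ (triple (Inverse.to π (fromℕ< {i} (<-trans (n<1+n i) (<-trans (n<1+n (suc i)) h))))
              (Inverse.to π (fromℕ< {suc i} (<-trans (n<1+n (suc i)) h)))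
              (Inverse.to π (fromℕ< {suc (suc i)} h))
       L.∈ blocks S)

-- Points are placed greedily in front of a 3-good sequence, always keeping two of
-- them in reserve.  The pair x, y at the front of the sequence lies in at most one
-- block, so at most one of the two reserve points completes it to a block, and the
-- other one can be placed.  When only the two reserve points p, q remain, either one
-- of them, say p, forms a block with the front pair, and then p q x y ... is 3-good
-- (the pair p, x already lies in the block {p, x, y}); or neither does, and one of
-- them goes in front while the other, chosen not to complete the last pair of the
-- sequence to a block, goes at the end.
module Submission where

open import Defs
open import Data.Nat using (ℕ; zero; suc; _<_; s≤s)
open import Data.Nat.Properties using (<-trans; n<1+n)
open import Data.Product using (Σ; _×_; _,_)
open import Data.Sum using (_⊎_; inj₁; inj₂)
open import Data.Unit using (⊤; tt)
open import Data.Empty using (⊥; ⊥-elim)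
import Data.Bool.Properties as Bool
open import Data.Fin using (Fin; cast; fromℕ<)
open import Data.Fin.Properties using (toℕ-injective; toℕ-cast; toℕ-fromℕ<; cast-involutive)
open import Data.Fin.Permutation using (cast-id; _∘ₚ_)
open import Data.Fin.Subset using (⁅_⁆; _∪_) renaming (_∈_ to _∈ₛ_)
open import Data.Fin.Subset.Properties using (x∈⁅x⁆; x∈⁅y⁆⇒x≡y; x∈p∪q⁺; x∈p∪q⁻; ∪-comm; ∪-assoc)
open import Data.List using (List; []; _∷_; _∷ʳ_; length; lookup; allFin)
open import Data.List.Properties using (length-tabulate; lookup-tabulate)
open import Data.List.Relation.Unary.All using (All; []; _∷_)
open import Data.List.Relation.Unary.AllPairs using (_∷_)
open import Data.List.Relation.Unary.Unique.Propositional using (Unique)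
open import Data.List.Relation.Unary.Unique.Propositional.Properties using (allFin⁺)
open import Data.List.Relation.Binary.Permutation.Propositional
  using (_↭_; ↭-refl; ↭-sym; ↭-trans; prep; swap; ↭⇒↭ₛ)
open import Data.List.Relation.Binary.Permutation.Propositional.Properties using (∷↭∷ʳ; ↭-length)
import Data.List.Relation.Binary.Permutation.Setoid.Properties as SetoidPerm
import Data.List.Relation.Binary.Permutation.Homogeneous as Homogeneous
open import Data.List.Membership.Propositional using (_∈_)
import Data.List.Membership.DecPropositional as DecMembership
open import Data.Vec.Properties using (≡-dec)
open import Function.Base using (id)
open import Function.Bundles using (Inverse)
open import Relation.Binary.PropositionalEquality
  using (_≡_; _≢_; refl; sym; ≢-sym; trans; cong; subst; setoid; module ≡-Reasoning)
open import Relation.Nullary using (¬_; Dec; yes; no)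

private
  variable
    v : ℕ
    a b c w x y z p q : Fin v

x∈triple : (x y z : Fin v) → x ∈ₛ triple x y z
x∈triple x y z = x∈p∪q⁺ (inj₁ (x∈⁅x⁆ x))

y∈triple : (x y z : Fin v) → y ∈ₛ triple x y z
y∈triple x y z = x∈p∪q⁺ (inj₂ (x∈p∪q⁺ (inj₁ (x∈⁅x⁆ y))))

z∈triple : (x y z : Fin v) → z ∈ₛ triple x y z
z∈triple x y z = x∈p∪q⁺ {p = ⁅ x ⁆} (inj₂ (x∈p∪q⁺ {p = ⁅ y ⁆} (inj₂ (x∈⁅x⁆ z))))

∈triple⁻ : w ∈ₛ triple x y z → w ≡ x ⊎ w ≡ y ⊎ w ≡ z
∈triple⁻ {x = x} {y} {z} w∈ with x∈p∪q⁻ ⁅ x ⁆ _ w∈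
... | inj₁ w∈x = inj₁ (x∈⁅y⁆⇒x≡y x w∈x)
... | inj₂ w∈yz with x∈p∪q⁻ ⁅ y ⁆ ⁅ z ⁆ w∈yz
...   | inj₁ w∈y = inj₂ (inj₁ (x∈⁅y⁆⇒x≡y y w∈y))
...   | inj₂ w∈z = inj₂ (inj₂ (x∈⁅y⁆⇒x≡y z w∈z))

triple-swap : (x y z : Fin v) → triple x y z ≡ triple y x z
triple-swap x y z = begin
  ⁅ x ⁆ ∪ (⁅ y ⁆ ∪ ⁅ z ⁆)  ≡⟨ sym (∪-assoc ⁅ x ⁆ ⁅ y ⁆ ⁅ z ⁆) ⟩
  (⁅ x ⁆ ∪ ⁅ y ⁆) ∪ ⁅ z ⁆  ≡⟨ cong (_∪ ⁅ z ⁆) (∪-comm ⁅ x ⁆ ⁅ y ⁆) ⟩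
  (⁅ y ⁆ ∪ ⁅ x ⁆) ∪ ⁅ z ⁆  ≡⟨ ∪-assoc ⁅ y ⁆ ⁅ x ⁆ ⁅ z ⁆ ⟩
  ⁅ y ⁆ ∪ (⁅ x ⁆ ∪ ⁅ z ⁆)  ∎
  where open ≡-Reasoning

triple-rotate : (x y z : Fin v) → triple x y z ≡ triple y z x
triple-rotate x y z = begin
  ⁅ x ⁆ ∪ (⁅ y ⁆ ∪ ⁅ z ⁆)  ≡⟨ ∪-comm ⁅ x ⁆ (⁅ y ⁆ ∪ ⁅ z ⁆) ⟩
  (⁅ y ⁆ ∪ ⁅ z ⁆) ∪ ⁅ x ⁆  ≡⟨ ∪-assoc ⁅ y ⁆ ⁅ z ⁆ ⁅ x ⁆ ⟩
  ⁅ y ⁆ ∪ (⁅ z ⁆ ∪ ⁅ x ⁆)  ∎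
  where open ≡-Reasoning

unique-resp-↭ : {xs ys : List (Fin v)} → xs ↭ ys → Unique ys → Unique xs
unique-resp-↭ {v} σ = SetoidPerm.Unique-resp-↭ (setoid (Fin v)) (↭⇒↭ₛ (↭-sym σ))

length-allFin : (n : ℕ) → length (allFin n) ≡ n
length-allFin n = length-tabulate id

lookup-allFin : (n : ℕ) (i : Fin (length (allFin n))) →
                lookup (allFin n) i ≡ cast (length-allFin n) i
lookup-allFin n i = begin
  lookup (allFin n) i                          ≡⟨ cong (lookup (allFin n)) (cast-involutive _ e i) ⟨
  lookup (allFin n) (cast (sym e) (cast e i))  ≡⟨ lookup-tabulate id (cast e i) ⟩
  cast e i                                     ∎
  where
  open ≡-Reasoning
  e : length (allFin n) ≡ n
  e = length-allFin n

length-↭-allFin : {L : List (Fin v)} → L ↭ allFin v → length L ≡ v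
length-↭-allFin {v} σ = trans (↭-length σ) (length-allFin v)

sequencing : {L : List (Fin v)} → L ↭ allFin v → Sequencing v
sequencing {v} σ =
  cast-id (sym (length-↭-allFin σ)) ∘ₚ Homogeneous.onIndices (↭⇒↭ₛ σ) ∘ₚ cast-id (length-allFin v)

sequencing-lookup : {L : List (Fin v)} (σ : L ↭ allFin v) (j : Fin v) →
                    Inverse.to (sequencing σ) j ≡ lookup L (cast (sym (length-↭-allFin σ)) j)
sequencing-lookup {v} σ j =
  sym (trans (SetoidPerm.onIndices-lookup (setoid (Fin v)) (↭⇒↭ₛ σ) _) (lookup-allFin v _))

cast-fromℕ< : {m n i : ℕ} .(e : m ≡ n) .(i<m : i < m) .(i<n : i < n) →
              cast e (fromℕ< i<m) ≡ fromℕ< i<n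
cast-fromℕ< e i<m i<n =
  toℕ-injective (trans (toℕ-cast e (fromℕ< i<m)) (trans (toℕ-fromℕ< i<m) (sym (toℕ-fromℕ< i<n))))

module _ (S : PSTS v) where

  Block : Fin v → Fin v → Fin v → Set
  Block x y z = triple x y z ∈ blocks S

  block? : (x y z : Fin v) → Dec (Block x y z)
  block? x y z = triple x y z ∈? blocks S
    where open DecMembership (≡-dec Bool._≟_)

  Block-cong : a ≡ x → b ≡ y → c ≡ z → Block a b c → Block x y z
  Block-cong refl refl refl B = B

  Block-swap : Block x y z → Block y x z
  Block-swap {x = x} {y} {z} = subst (_∈ blocks S) (triple-swap x y z)

  Block-rotate : Block x y z → Block y z x
  Block-rotate {x = x} {y} {z} = subst (_∈ blocks S) (triple-rotate x y z)

  third-point-unique : x ≢ y → a ≢ x → a ≢ y → Block a x y → Block b x y → a ≡ b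
  third-point-unique {x = x} {y} {a} {b} x≢y a≢x a≢y Ba Bb
    with ∈triple⁻ (subst (a ∈ₛ_) same-block (x∈triple a x y))
    where
    same-block : triple a x y ≡ triple b x y
    same-block = pair-unique S x y x≢y Ba Bb
      (y∈triple a x y) (z∈triple a x y) (y∈triple b x y) (z∈triple b x y)
  ... | inj₁ a≡b = a≡b
  ... | inj₂ (inj₁ a≡x) = ⊥-elim (a≢x a≡x)
  ... | inj₂ (inj₂ a≡y) = ⊥-elim (a≢y a≡y)

  ThreeGoodList : List (Fin v) → Set
  ThreeGoodList (x ∷ y ∷ z ∷ xs) = ¬ Block x y z × ThreeGoodList (y ∷ z ∷ xs)
  ThreeGoodList _ = ⊤

  LastPairBlock : List (Fin v) → Fin v → Set
  LastPairBlock (x ∷ y ∷ []) w = Block x y w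
  LastPairBlock (x ∷ y ∷ z ∷ xs) w = LastPairBlock (y ∷ z ∷ xs) w
  LastPairBlock _ _ = ⊥

  lastPairBlock? : (xs : List (Fin v)) (w : Fin v) → Dec (LastPairBlock xs w)
  lastPairBlock? (x ∷ y ∷ []) w = block? x y w
  lastPairBlock? (x ∷ y ∷ z ∷ xs) w = lastPairBlock? (y ∷ z ∷ xs) w
  lastPairBlock? [] w = no λ ()
  lastPairBlock? (x ∷ []) w = no λ ()

  ThreeGoodList-∷ʳ : (xs : List (Fin v)) → ThreeGoodList xs → ¬ LastPairBlock xs w →
                     ThreeGoodList (xs ∷ʳ w)
  ThreeGoodList-∷ʳ [] _ _ = tt
  ThreeGoodList-∷ʳ (x ∷ []) _ _ = tt
  ThreeGoodList-∷ʳ (x ∷ y ∷ []) _ ¬B = ¬B , tt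
  ThreeGoodList-∷ʳ (x ∷ y ∷ z ∷ xs) (¬B , good) ¬B′ = ¬B , ThreeGoodList-∷ʳ (y ∷ z ∷ xs) good ¬B′

  LastPairBlock-unique : {xs : List (Fin v)} → p ≢ q → All (p ≢_) xs → All (q ≢_) xs →
                         Unique xs → LastPairBlock xs p → ¬ LastPairBlock xs q
  LastPairBlock-unique {xs = x ∷ y ∷ []} p≢q (p≢x ∷ p≢y ∷ []) _ ((x≢y ∷ []) ∷ _) Bp Bq =
    p≢q (third-point-unique x≢y p≢x p≢y (Block-rotate (Block-rotate Bp))
                                         (Block-rotate (Block-rotate Bq)))
  LastPairBlock-unique {xs = x ∷ y ∷ z ∷ xs} p≢q (_ ∷ p∉) (_ ∷ q∉) (_ ∷ u) =
    LastPairBlock-unique p≢q p∉ q∉ u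

  record PartialSequencing (Z : List (Fin v)) : Set where
    constructor partial
    field
      spare₁ spare₂ first second : Fin v
      rest : List (Fin v)
      good : ThreeGoodList (first ∷ second ∷ rest)
      perm : spare₁ ∷ spare₂ ∷ first ∷ second ∷ rest ↭ Z

  extend : {Z : List (Fin v)} → Unique (z ∷ Z) → PartialSequencing Z → PartialSequencing (z ∷ Z)
  extend {z = z} (_ ∷ u) (partial p q x y T good σ) with unique-resp-↭ σ u | block? p x y
  ... | _ | no ¬Bp = partial z q p x (y ∷ T) (¬Bp , good) (prep z (↭-trans (swap q p ↭-refl) σ))
  ... | (p≢q ∷ p≢x ∷ p≢y ∷ _) ∷ _ ∷ (x≢y ∷ _) ∷ _ | yes Bp =
    partial z p q x (y ∷ T) (¬Bq , good) (prep z σ)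
    where
    ¬Bq : ¬ Block q x y
    ¬Bq Bq = p≢q (third-point-unique x≢y p≢x p≢y Bp Bq)

  partialSequencing : (a b c d : Fin v) (R : List (Fin v)) → Unique (a ∷ b ∷ c ∷ d ∷ R) →
                      PartialSequencing (a ∷ b ∷ c ∷ d ∷ R)
  partialSequencing a b c d [] _ = partial a b c d [] tt ↭-refl
  partialSequencing a b c d (r ∷ R) u@(_ ∷ u′) = extend u (partialSequencing b c d r R u′)

  ThreeGoodList-front-pair : {T : List (Fin v)} → Unique (p ∷ q ∷ x ∷ y ∷ T) → Block p x y →
                    ThreeGoodList (x ∷ y ∷ T) → ThreeGoodList (p ∷ q ∷ x ∷ y ∷ T)
  ThreeGoodList-front-pair {p = p} {q} {x} {y}
      ((p≢q ∷ p≢x ∷ p≢y ∷ _) ∷ (_ ∷ q≢y ∷ _) ∷ (x≢y ∷ _) ∷ _) Bp good = ¬Bpqx , ¬Bq , good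
    where
    ¬Bq : ¬ Block q x y
    ¬Bq Bq = p≢q (third-point-unique x≢y p≢x p≢y Bp Bq)
    ¬Bpqx : ¬ Block p q x
    ¬Bpqx Bpqx = q≢y (sym (third-point-unique p≢x (≢-sym p≢y) (≢-sym x≢y)
                                              (Block-rotate (Block-rotate Bp)) (Block-swap Bpqx)))

  completeSequencing : {Z : List (Fin v)} → Unique Z → PartialSequencing Z →
                       Σ (List (Fin v)) λ G → ThreeGoodList G × G ↭ Z
  completeSequencing u (partial p q x y T good σ)
    with unique-resp-↭ σ u | block? p x y | block? q x y
  ... | u′ | yes Bp | _ = p ∷ q ∷ x ∷ y ∷ T , ThreeGoodList-front-pair u′ Bp good , σ
  ... | u′ | no _ | yes Bq =
    q ∷ p ∷ x ∷ y ∷ T , ThreeGoodList-front-pair (unique-resp-↭ (swap q p ↭-refl) u′) Bq good ,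
    ↭-trans (swap q p ↭-refl) σ
  ... | (p≢q ∷ p∉ ∷ p∉′) ∷ (q∉ ∷ q∉′) ∷ uG | no ¬Bp | no ¬Bq
    with lastPairBlock? (x ∷ y ∷ T) q
  ...   | no ¬Eq = p ∷ (x ∷ y ∷ T) ∷ʳ q , (¬Bp , ThreeGoodList-∷ʳ (x ∷ y ∷ T) good ¬Eq) ,
                   ↭-trans (prep p (↭-sym (∷↭∷ʳ q (x ∷ y ∷ T)))) σ
  ...   | yes Eq = q ∷ (x ∷ y ∷ T) ∷ʳ p , (¬Bq , ThreeGoodList-∷ʳ (x ∷ y ∷ T) good ¬Ep) ,
                   ↭-trans (prep q (↭-sym (∷↭∷ʳ p (x ∷ y ∷ T)))) (↭-trans (swap q p ↭-refl) σ)
    where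
    ¬Ep : ¬ LastPairBlock (x ∷ y ∷ T) p
    ¬Ep = LastPairBlock-unique (≢-sym p≢q) (q∉ ∷ q∉′) (p∉ ∷ p∉′) uG Eq

  -- The bounds are those of ThreeGood; fromℕ< takes them irrelevantly, so any proofs match.
  ThreeGoodList-lookup : (xs : List (Fin v)) → ThreeGoodList xs →
                         (i : ℕ) (h : suc (suc i) < length xs) →
                         ¬ Block (lookup xs (fromℕ< (<-trans (n<1+n i) (<-trans (n<1+n (suc i)) h))))
                                 (lookup xs (fromℕ< (<-trans (n<1+n (suc i)) h)))
                                 (lookup xs (fromℕ< h))
  ThreeGoodList-lookup (x ∷ []) _ _ (s≤s ())
  ThreeGoodList-lookup (x ∷ y ∷ []) _ _ (s≤s (s≤s ()))
  ThreeGoodList-lookup (x ∷ y ∷ z ∷ xs) (¬B , _) zero _ = ¬B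
  ThreeGoodList-lookup (x ∷ y ∷ z ∷ xs) (_ , good) (suc i) (s≤s h) =
    ThreeGoodList-lookup (y ∷ z ∷ xs) good i h

  ThreeGoodList⇒ThreeGood : {G : List (Fin v)} (σ : G ↭ allFin v) → ThreeGoodList G →
                            ThreeGood S (sequencing σ)
  ThreeGoodList⇒ThreeGood {G = G} σ good i h B =
    ThreeGoodList-lookup G good i (in-G h)
      (Block-cong (position (<-trans (n<1+n i) (<-trans (n<1+n (suc i)) h)))
                  (position (<-trans (n<1+n (suc i)) h)) (position h) B)
    where
    in-G : {k : ℕ} → k < v → k < length G
    in-G {k} = subst (k <_) (sym (length-↭-allFin σ))
    position : {k : ℕ} (k<v : k < v) →
               Inverse.to (sequencing σ) (fromℕ< k<v) ≡ lookup G (fromℕ< (in-G k<v))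
    position k<v =
      trans (sequencing-lookup σ (fromℕ< k<v)) (cong (lookup G) (cast-fromℕ< _ k<v (in-G k<v)))

theorem3 : (v : ℕ) → 3 < v → (S : PSTS v) →
    Σ (Sequencing v) (λ π → ThreeGood S π)
theorem3 _ (s≤s (s≤s (s≤s (s≤s _)))) S =
  let G , good , σ = completeSequencing S (allFin⁺ _) (partialSequencing S _ _ _ _ _ (allFin⁺ _))
  in sequencing σ , ThreeGoodList⇒ThreeGood S σ good
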